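{- Let $\overline{\mathcal{P}}^*(n)$ be the number of gap-free overpartitions of $n$, i.e., overpartitions of $n$ in which no positive integer less than the largest part is missing (with $\overline{\mathcal{P}}^*(0)=1$). Then, for $|q|<1$, \[ \sum_{n=0}^{\infty} \overline{\mathcal{P}}^*(n)q^n=(-2q;q)_{\infty}. \] Consequently, $\overline{\mathcal{P}}^*(n)$ equals the number of overpartitions of $n$ in which every integer occurs at most once in total (either non-overlined or overlined, but not both).
   Context: An overpartition of $n$ is a partition of $n$ in which the first occurrence of any integer may be overlined. The largest part is the largest integer occurring (overlined or not). A positive integer less than the largest part is missing if it occurs neither overlined nor non-overlined. Notation: $(a;q)_\infty=\prod_{i\ge1}(1-aq^{i-1})$. -}

module Defs where

open import Data.Nat using (ℕ; zero; suc; _+_; _*_; _<_; _≤_; _⊔_)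
open import Data.Bool using (Bool; true; false)
open import Data.Product using (_×_; _,_; proj₁; Σ)
open import Data.Sum using (_⊎_)
open import Data.List using (List; []; _∷_; map; foldr; length; replicate; _++_; [_])
open import Data.Nat.ListAction using (sum)
open import Data.List.Relation.Unary.All using (All)
open import Data.List.Relation.Unary.Linked using (Linked)
open import Data.List.Relation.Unary.Unique.Propositional using (Unique)
open import Data.List.Membership.Propositional using (_∈_)
open import Relation.Binary.PropositionalEquality using (_≡_)
open import Function.Bundles using (_⇔_)

-- An overpartition is represented as a list of tagged parts (k , b):
-- k is the part (a positive integer), b = true means "overlined".
-- The list is in canonical order: parts weakly decreasing, and among equal
-- parts the (unique, optional) overlined copy comes first.  Hence the
-- first occurrence of any integer may be overlined, and only that one.

Part : Set
Part = ℕ × Bool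

MayPrecede : Part → Part → Set
MayPrecede (k , b) (k' , b') = (k' < k) ⊎ (k' ≡ k × b' ≡ false)

parts : List Part → List ℕ
parts = map proj₁

IsOverpartition : ℕ → List Part → Set
IsOverpartition n xs =
  All (λ p → 1 ≤ proj₁ p) xs × Linked MayPrecede xs × sum (parts xs) ≡ n

largestPart : List Part → ℕ
largestPart xs = foldr _⊔_ 0 (parts xs)

GapFree : List Part → Set
GapFree xs = ∀ j → 1 ≤ j → j < largestPart xs → j ∈ parts xs

DistinctInTotal : List Part → Set
DistinctInTotal xs = Unique (parts xs)

GapFreeOverpartition : ℕ → List Part → Set
GapFreeOverpartition n xs = IsOverpartition n xs × GapFree xs

DistinctOverpartition : ℕ → List Part → Set
DistinctOverpartition n xs = IsOverpartition n xs × DistinctInTotal xs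

HasCount : {A : Set} → (A → Set) → ℕ → Set
HasCount {A} P m =
  Σ (List A) λ L → Unique L × (∀ x → (x ∈ L) ⇔ P x) × length L ≡ m

-- Polynomials over ℕ as coefficient lists (index i = coefficient of q^i)

_⊕_ : List ℕ → List ℕ → List ℕ
[] ⊕ q = q
(a ∷ p) ⊕ [] = a ∷ p
(a ∷ p) ⊕ (b ∷ q) = (a + b) ∷ (p ⊕ q)

_⊛_ : List ℕ → List ℕ → List ℕ
[] ⊛ q = []
(a ∷ p) ⊛ q = map (a *_) q ⊕ (0 ∷ (p ⊛ q))

coeffAt : List ℕ → ℕ → ℕ
coeffAt [] _ = 0
coeffAt (a ∷ p) zero = a
coeffAt (a ∷ p) (suc k) = coeffAt p k

-- the factor (1 + 2 q^(j+1))
factor : ℕ → List ℕ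
factor j = 1 ∷ (replicate j 0 ++ [ 2 ])

partialProd : ℕ → List ℕ
partialProd zero = [ 1 ]
partialProd (suc j) = partialProd j ⊛ factor j

-- coefficient of q^n in (-2q;q)_∞ = ∏_{i≥1}(1+2q^i); factors with i > n
-- do not affect it, so it is the q^n coefficient of ∏_{i=1}^{n}(1+2q^i).
coeffMinus2q : ℕ → ℕ
coeffMinus2q n = coeffAt (partialProd n) n

-- The coefficients c_N(n) of q^n in ∏_{i=1}^{N} (1 + 2q^i) satisfy c_0(n) = [n = 0] and
-- c_{N+1}(n) = c_N(n) + 2 c_N(n − N − 1).  Overpartitions of n in which every integer occurs at
-- most once and all parts are at most N obey the same recurrence: N + 1 is either absent or a
-- single part, overlined or not.  So do gap-free overpartitions of n with at most N parts: one with
-- exactly N + 1 parts has 1 as a part, and deleting the first column of its Ferrers diagram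
-- (lowering every part by one and dropping the 1s) leaves a gap-free overpartition of n − N − 1
-- with at most N parts, the overline on the first 1 being the only information lost.  For N = n
-- the bounds are vacuous.
module Submission where

open import Defs
open import Data.Nat using (ℕ; zero; suc; _+_; _*_; _∸_; _≤_; _<_; _⊔_; z≤n; s≤s)
open import Data.Nat.Properties
open import Data.Bool using (Bool; true; false)
open import Data.Product using (_×_; _,_; proj₁; proj₂; Σ; map₁)
open import Data.Sum using (_⊎_; inj₁; inj₂)
open import Function using (_∘_)
open import Function.Bundles using (_⇔_; mk⇔)
import Function.Properties.Equivalence as ⇔
open import Relation.Nullary using (¬_)
open import Relation.Binary.PropositionalEquality hiding ([_])
open import Data.List using (List; []; _∷_; map; foldr; length; replicate; _++_; [_])
open import Data.List.Properties
  using (∷-injectiveˡ; ∷-injectiveʳ; length-++; length-map; length-replicate; map-++; map-∘; map-replicate)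
open import Data.Nat.ListAction using (sum)
open import Data.Nat.ListAction.Properties using (sum-++)
open import Data.List.Relation.Unary.All as All using (All; []; _∷_)
import Data.List.Relation.Unary.All.Properties as Allₚ
open import Data.List.Relation.Unary.Any using (here; there)
open import Data.List.Relation.Unary.Linked as Linked using (Linked; []; [-]; _∷_)
open import Data.List.Membership.Propositional using (_∈_)
open import Data.List.Membership.Propositional.Properties using (∈-++⁺ˡ; ∈-++⁺ʳ; ∈-++⁻; ∈-map⁺; ∈-map⁻)
open import Data.List.Relation.Unary.Unique.Propositional using (Unique; []; _∷_)
open import Data.List.Relation.Unary.Unique.Propositional.Properties using (++⁺)
open import Data.List.Relation.Binary.Disjoint.Propositional using (Disjoint)
open import Algebra.Properties.CommutativeSemigroup +-commutativeSemigroup using (x∙yz≈y∙xz)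
open ≡-Reasoning

shift : {A : Set} → A → ℕ → (ℕ → A) → ℕ → A
shift d zero    g k       = g k
shift d (suc j) g zero    = d
shift d (suc j) g (suc k) = shift d j g k

shift-map : {A B : Set} (h : A → B) {d : A} {g : ℕ → A} {d′ : B} {g′ : ℕ → B} →
            h d ≡ d′ → (∀ m → h (g m) ≡ g′ m) →
            ∀ j k → h (shift d j g k) ≡ shift d′ j g′ k
shift-map h hd hg zero    k       = hg k
shift-map h hd hg (suc j) zero    = hd
shift-map h hd hg (suc j) (suc k) = shift-map h hd hg j k

shift-preserves : {A : Set} (P : A → Set) {d : A} {g : ℕ → A} →
                  P d → (∀ m → P (g m)) → ∀ j k → P (shift d j g k)
shift-preserves P pd pg zero    k       = pg k
shift-preserves P pd pg (suc j) zero    = pd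
shift-preserves P pd pg (suc j) (suc k) = shift-preserves P pd pg j k

∈-shift⁻ : {A : Set} {x : A} {g : ℕ → List A} →
           ∀ j k → x ∈ shift [] j g k → j ≤ k × x ∈ g (k ∸ j)
∈-shift⁻ zero    k       x∈ = z≤n , x∈
∈-shift⁻ (suc j) (suc k) x∈ with ∈-shift⁻ j k x∈
... | j≤k , x∈′ = s≤s j≤k , x∈′

∈-shift⁺ : {A : Set} {x : A} {g : ℕ → List A} →
           ∀ j k → j ≤ k → x ∈ g (k ∸ j) → x ∈ shift [] j g k
∈-shift⁺ zero    k       _         x∈ = x∈
∈-shift⁺ (suc j) (suc k) (s≤s j≤k) x∈ = ∈-shift⁺ j k j≤k x∈

coeffAt-⊕ : ∀ p q k → coeffAt (p ⊕ q) k ≡ coeffAt p k + coeffAt q k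
coeffAt-⊕ []      q       k       = refl
coeffAt-⊕ (a ∷ p) []      k       = sym (+-identityʳ _)
coeffAt-⊕ (a ∷ p) (b ∷ q) zero    = refl
coeffAt-⊕ (a ∷ p) (b ∷ q) (suc k) = coeffAt-⊕ p q k

coeffAt-scale : ∀ a q k → coeffAt (map (a *_) q) k ≡ a * coeffAt q k
coeffAt-scale a []      k       = sym (*-zeroʳ a)
coeffAt-scale a (b ∷ q) zero    = refl
coeffAt-scale a (b ∷ q) (suc k) = coeffAt-scale a q k

coeffAt-⊛-[] : ∀ p k → coeffAt (p ⊛ []) k ≡ 0
coeffAt-⊛-[] []      k       = refl
coeffAt-⊛-[] (a ∷ p) zero    = refl
coeffAt-⊛-[] (a ∷ p) (suc k) = coeffAt-⊛-[] p k

coeffAt-⊛-∷ : ∀ p b q k → coeffAt (p ⊛ (b ∷ q)) k ≡ b * coeffAt p k + coeffAt (0 ∷ (p ⊛ q)) k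
coeffAt-⊛-∷ []      b q zero    = sym (trans (+-identityʳ _) (*-zeroʳ b))
coeffAt-⊛-∷ []      b q (suc k) = sym (trans (+-identityʳ _) (*-zeroʳ b))
coeffAt-⊛-∷ (a ∷ p) b q zero    = cong (_+ 0) (*-comm a b)
coeffAt-⊛-∷ (a ∷ p) b q (suc k) = begin
  coeffAt (map (a *_) q ⊕ (p ⊛ (b ∷ q))) k
    ≡⟨ coeffAt-⊕ (map (a *_) q) (p ⊛ (b ∷ q)) k ⟩
  coeffAt (map (a *_) q) k + coeffAt (p ⊛ (b ∷ q)) k
    ≡⟨ cong₂ _+_ (coeffAt-scale a q k) (coeffAt-⊛-∷ p b q k) ⟩
  a * coeffAt q k + (b * coeffAt p k + coeffAt (0 ∷ (p ⊛ q)) k)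
    ≡⟨ x∙yz≈y∙xz (a * coeffAt q k) (b * coeffAt p k) _ ⟩
  b * coeffAt p k + (a * coeffAt q k + coeffAt (0 ∷ (p ⊛ q)) k)
    ≡⟨ cong (b * coeffAt p k +_) (sym (trans (coeffAt-⊕ (map (a *_) q) (0 ∷ (p ⊛ q)) k)
                                              (cong (_+ _) (coeffAt-scale a q k)))) ⟩
  b * coeffAt p k + coeffAt (map (a *_) q ⊕ (0 ∷ (p ⊛ q))) k
    ∎

coeffAt-⊛-monomial : ∀ c j p k → coeffAt (p ⊛ (replicate j 0 ++ [ c ])) k ≡ c * shift 0 j (coeffAt p) k
coeffAt-⊛-monomial c zero    p zero    = trans (coeffAt-⊛-∷ p c [] zero) (+-identityʳ _)
coeffAt-⊛-monomial c zero    p (suc k) =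
  trans (coeffAt-⊛-∷ p c [] (suc k))
        (trans (cong (c * coeffAt p (suc k) +_) (coeffAt-⊛-[] p k)) (+-identityʳ _))
coeffAt-⊛-monomial c (suc j) p zero    = trans (coeffAt-⊛-∷ p 0 _ zero) (sym (*-zeroʳ c))
coeffAt-⊛-monomial c (suc j) p (suc k) = trans (coeffAt-⊛-∷ p 0 _ (suc k)) (coeffAt-⊛-monomial c j p k)

coeffAt-⊛-factor : ∀ p N n → coeffAt (p ⊛ factor N) n ≡ coeffAt p n + 2 * shift 0 (suc N) (coeffAt p) n
coeffAt-⊛-factor p N zero    = trans (coeffAt-⊛-∷ p 1 _ zero) (cong (_+ 0) (*-identityˡ _))
coeffAt-⊛-factor p N (suc n) =
  trans (coeffAt-⊛-∷ p 1 _ (suc n)) (cong₂ _+_ (*-identityˡ _) (coeffAt-⊛-monomial 2 N p n))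

HasCount-resp-⇔ : {A : Set} {P Q : A → Set} {m : ℕ} → (∀ x → P x ⇔ Q x) → HasCount P m → HasCount Q m
HasCount-resp-⇔ P⇔Q (L , unique , ∈⇔P , length≡) =
  L , unique , (λ x → ⇔.trans (∈⇔P x) (P⇔Q x)) , length≡

map⁺-injectiveOn : {A B : Set} {P : A → Set} {f : A → B} →
                   (∀ {x y} → P x → P y → f x ≡ f y → x ≡ y) →
                   ∀ {xs} → All P xs → Unique xs → Unique (map f xs)
map⁺-injectiveOn inj [] [] = []
map⁺-injectiveOn {P = P} {f} inj (px ∷ pxs) (x∉xs ∷ unique) =
  fresh px pxs x∉xs ∷ map⁺-injectiveOn inj pxs unique
  where
  fresh : ∀ {x ys} → P x → All P ys → All (x ≢_) ys → All (f x ≢_) (map f ys)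
  fresh px′ [] [] = []
  fresh px′ (py ∷ pys) (x≢y ∷ x≢ys) = (λ fx≡fy → x≢y (inj px′ py fx≡fy)) ∷ fresh px′ pys x≢ys

module Enumeration {A : Set} (empty : A) (grow : Bool → ℕ → A → A) where

  mutual
    enumerate : ℕ → ℕ → List A
    enumerate zero    zero    = [ empty ]
    enumerate zero    (suc n) = []
    enumerate (suc N) n       = enumerate N n ++ grown N n

    seeds : ℕ → ℕ → List A
    seeds N = shift [] (suc N) (enumerate N)

    grown : ℕ → ℕ → List A
    grown N n = map (grow false N) (seeds N n) ++ map (grow true N) (seeds N n)

  GrownFrom : ℕ → (ℕ → A → Set) → ℕ → A → Set
  GrownFrom N P n x = Σ Bool λ b → Σ A λ y → suc N ≤ n × P (n ∸ suc N) y × x ≡ grow b N y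

  length-enumerate : ∀ N n → length (enumerate N n) ≡ coeffAt (partialProd N) n
  length-enumerate zero    zero    = refl
  length-enumerate zero    (suc n) = refl
  length-enumerate (suc N) n       = begin
    length (enumerate N n ++ grown N n)
      ≡⟨ length-++ (enumerate N n) ⟩
    length (enumerate N n) + length (map (grow false N) S ++ map (grow true N) S)
      ≡⟨ cong (length (enumerate N n) +_) (trans (length-++ (map (grow false N) S))
                                             (cong₂ _+_ (length-map _ S) (length-map _ S))) ⟩
    length (enumerate N n) + (length S + length S)
      ≡⟨ cong₂ _+_ (length-enumerate N n) (cong (λ s → s + s) length-seeds) ⟩
    coeffAt P n + (s + s)
      ≡⟨ cong (λ t → coeffAt P n + (s + t)) (sym (+-identityʳ s)) ⟩
    coeffAt P n + 2 * s
      ≡⟨ coeffAt-⊛-factor P N n ⟨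
    coeffAt (partialProd (suc N)) n
      ∎
    where
    P = partialProd N
    S = seeds N n
    s = shift 0 (suc N) (coeffAt P) n
    length-seeds : length S ≡ s
    length-seeds = shift-map length refl (length-enumerate N) (suc N) n

  Enumerated : ℕ → ℕ → A → Set
  Enumerated N n x = x ∈ enumerate N n

  ∈-map-seeds⁻ : ∀ {N n x} b → x ∈ map (grow b N) (seeds N n) → GrownFrom N (Enumerated N) n x
  ∈-map-seeds⁻ {N} {n} b x∈ with ∈-map⁻ (grow b N) x∈
  ... | y , y∈ , x≡ with ∈-shift⁻ (suc N) n y∈
  ... | N<n , y∈′ = b , y , N<n , y∈′ , x≡

  ∈-grown⁻ : ∀ {N n x} → x ∈ grown N n → GrownFrom N (Enumerated N) n x
  ∈-grown⁻ {N} {n} x∈ with ∈-++⁻ (map (grow false N) (seeds N n)) x∈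
  ... | inj₁ x∈false = ∈-map-seeds⁻ false x∈false
  ... | inj₂ x∈true  = ∈-map-seeds⁻ true x∈true

  ∈-grown⁺ : ∀ {N n x} → GrownFrom N (Enumerated N) n x → x ∈ grown N n
  ∈-grown⁺ {N} {n} (false , y , N<n , y∈ , refl) =
    ∈-++⁺ˡ (∈-map⁺ (grow false N) (∈-shift⁺ (suc N) n N<n y∈))
  ∈-grown⁺ {N} {n} (true  , y , N<n , y∈ , refl) =
    ∈-++⁺ʳ (map (grow false N) (seeds N n)) (∈-map⁺ (grow true N) (∈-shift⁺ (suc N) n N<n y∈))

  -- F N n x says that x is one of the objects counted by the coefficient of q^n in partialProd N.
  record Recurrence (F : ℕ → ℕ → A → Set) : Set where
    field
      base           : F 0 0 empty
      base⁻          : ∀ {n x} → F 0 n x → n ≡ 0 × x ≡ empty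
      weaken         : ∀ {N n x} → F N n x → F (suc N) n x
      grow⁺          : ∀ {N n b y} → suc N ≤ n → F N (n ∸ suc N) y → F (suc N) n (grow b N y)
      step⁻          : ∀ {N n x} → F (suc N) n x → F N n x ⊎ GrownFrom N (F N) n x
      grow-fresh     : ∀ {N m n b y} → F N m y → ¬ F N n (grow b N y)
      grow-injective : ∀ {N m b b′ y y′} → F N m y → F N m y′ →
                       grow b N y ≡ grow b′ N y′ → b ≡ b′ × y ≡ y′

  module _ {F : ℕ → ℕ → A → Set} (R : Recurrence F) where
    open Recurrence R

    enumerate-sound : ∀ N n {x} → x ∈ enumerate N n → F N n x
    enumerate-sound zero    zero (here refl) = base
    enumerate-sound (suc N) n    x∈ with ∈-++⁻ (enumerate N n) x∈
    ... | inj₁ x∈old = weaken (enumerate-sound N n x∈old)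
    ... | inj₂ x∈new with ∈-grown⁻ {N} {n} x∈new
    ... | b , y , N<n , y∈ , refl = grow⁺ N<n (enumerate-sound N _ y∈)

    enumerate-complete : ∀ N n {x} → F N n x → x ∈ enumerate N n
    enumerate-complete zero    n Fx with base⁻ Fx
    ... | refl , refl = here refl
    enumerate-complete (suc N) n Fx with step⁻ Fx
    ... | inj₁ Fx′                      = ∈-++⁺ˡ (enumerate-complete N n Fx′)
    ... | inj₂ (b , y , N<n , Fy , x≡) =
      ∈-++⁺ʳ (enumerate N n) (∈-grown⁺ {N} {n} (b , y , N<n , enumerate-complete N _ Fy , x≡))

    enumerate-unique : ∀ N n → Unique (enumerate N n)
    enumerate-unique zero    zero    = [] ∷ []
    enumerate-unique zero    (suc n) = []
    enumerate-unique (suc N) n       =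
      ++⁺ (enumerate-unique N n) (++⁺ (grown-unique false) (grown-unique true) false-true-disjoint)
          old-grown-disjoint
      where
      S = seeds N n
      F-seed : ∀ {y} → y ∈ S → F N (n ∸ suc N) y
      F-seed y∈ = enumerate-sound N _ (proj₂ (∈-shift⁻ (suc N) n y∈))
      grown-unique : ∀ b → Unique (map (grow b N) S)
      grown-unique b = map⁺-injectiveOn (λ Fy Fy′ eq → proj₂ (grow-injective Fy Fy′ eq))
                                        (All.tabulate F-seed)
                                        (shift-preserves Unique [] (enumerate-unique N) (suc N) n)
      false-true-disjoint : Disjoint (map (grow false N) S) (map (grow true N) S)
      false-true-disjoint (v∈false , v∈true) with ∈-map⁻ _ v∈false | ∈-map⁻ _ v∈true
      ... | y , y∈ , refl | y′ , y′∈ , v≡ with grow-injective (F-seed y∈) (F-seed y′∈) v≡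
      ... | () , _
      old-grown-disjoint : Disjoint (enumerate N n) (grown N n)
      old-grown-disjoint (v∈old , v∈grown) with ∈-grown⁻ {N} {n} v∈grown
      ... | b , y , _ , y∈ , refl = grow-fresh (enumerate-sound N _ y∈) (enumerate-sound N n v∈old)

    hasCount : ∀ N n → HasCount (F N n) (coeffAt (partialProd N) n)
    hasCount N n = enumerate N n , enumerate-unique N n ,
                   (λ x → mk⇔ (enumerate-sound N n) (enumerate-complete N n)) , length-enumerate N n

∈⇒≤foldr-⊔ : ∀ {k ks} → k ∈ ks → k ≤ foldr _⊔_ 0 ks
∈⇒≤foldr-⊔ {k} {_ ∷ ks} (here refl) = m≤m⊔n k (foldr _⊔_ 0 ks)
∈⇒≤foldr-⊔ {k} {k′ ∷ _} (there k∈) = m≤n⇒m≤o⊔n k′ (∈⇒≤foldr-⊔ k∈)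

<foldr-⊔⇒∃ : ∀ {j} ks → j < foldr _⊔_ 0 ks → Σ ℕ λ k → k ∈ ks × j < k
<foldr-⊔⇒∃ (k ∷ ks) j< with ⊔-sel k (foldr _⊔_ 0 ks)
... | inj₁ ⊔≡k = k , here refl , subst (_ <_) ⊔≡k j<
... | inj₂ ⊔≡r with <foldr-⊔⇒∃ ks (subst (_ <_) ⊔≡r j<)
... | k′ , k′∈ , j<k′ = k′ , there k′∈ , j<k′

NoGaps : List ℕ → Set
NoGaps ks = ∀ {j k} → 1 ≤ j → j < k → k ∈ ks → j ∈ ks

gapFree⇒noGaps : ∀ {x} → GapFree x → NoGaps (parts x)
gapFree⇒noGaps gapFree 1≤j j<k k∈ = gapFree _ 1≤j (<-≤-trans j<k (∈⇒≤foldr-⊔ k∈))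

noGaps⇒gapFree : ∀ {x} → NoGaps (parts x) → GapFree x
noGaps⇒gapFree {x} noGaps j 1≤j j<max with <foldr-⊔⇒∃ (parts x) j<max
... | k , k∈ , j<k = noGaps 1≤j j<k k∈

noGaps⇒1∈ : ∀ {k ks} → NoGaps ks → 1 ≤ k → k ∈ ks → 1 ∈ ks
noGaps⇒1∈ {suc zero}    noGaps _ k∈ = k∈
noGaps⇒1∈ {suc (suc k)} noGaps _ k∈ = noGaps ≤-refl (s≤s (s≤s z≤n)) k∈

∈-replicate-1 : ∀ {k} m → k ∈ replicate m 1 → k ≡ 1
∈-replicate-1 m = All.lookup (Allₚ.replicate⁺ {P = _≡ 1} m refl)

noGaps-column⁺ : ∀ {ks} h → NoGaps ks → NoGaps (map suc ks ++ replicate (suc h) 1)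
noGaps-column⁺ {ks} h noGaps {suc zero}     _ _ _ = ∈-++⁺ʳ (map suc ks) (here refl)
noGaps-column⁺ {ks} h noGaps {suc (suc i)} _ i+2<k k∈ with ∈-++⁻ (map suc ks) k∈
... | inj₁ k∈suc with ∈-map⁻ suc k∈suc
...   | k′ , k′∈ , refl = ∈-++⁺ˡ (∈-map⁺ suc (noGaps (s≤s z≤n) (≤-pred i+2<k) k′∈))
noGaps-column⁺ {ks} h noGaps {suc (suc i)} _ i+2<k k∈ | inj₂ k∈ones
  with ∈-replicate-1 (suc h) k∈ones
... | refl with i+2<k
...   | s≤s ()

noGaps-column⁻ : ∀ {ks} h → NoGaps (map suc ks ++ replicate (suc h) 1) → NoGaps ks
noGaps-column⁻ {ks} h noGaps {j} 1≤j j<k k∈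
  with ∈-++⁻ (map suc ks) (noGaps (s≤s z≤n) (s≤s j<k) (∈-++⁺ˡ (∈-map⁺ suc k∈)))
... | inj₁ j+1∈suc with ∈-map⁻ suc j+1∈suc
...   | j′ , j′∈ , refl = j′∈
noGaps-column⁻ {ks} h noGaps {suc j} 1≤j j<k k∈ | inj₂ j+1∈ones with ∈-replicate-1 (suc h) j+1∈ones
... | ()

sum-map-suc : ∀ ks → sum (map suc ks) ≡ sum ks + length ks
sum-map-suc []       = refl
sum-map-suc (k ∷ ks) = begin
  suc (k + sum (map suc ks))        ≡⟨ cong (λ s → suc (k + s)) (sum-map-suc ks) ⟩
  suc (k + (sum ks + length ks))    ≡⟨ cong suc (+-assoc k (sum ks) (length ks)) ⟨
  suc (k + sum ks + length ks)      ≡⟨ +-suc (k + sum ks) (length ks) ⟨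
  k + sum ks + suc (length ks)      ∎

sum-replicate-1 : ∀ m → sum (replicate m 1) ≡ m
sum-replicate-1 zero    = refl
sum-replicate-1 (suc m) = cong suc (sum-replicate-1 m)

Positive : List Part → Set
Positive = All (λ p → 1 ≤ proj₁ p)

length≤sum : ∀ {x} → Positive x → length x ≤ sum (parts x)
length≤sum []          = z≤n
length≤sum (1≤k ∷ pos) = +-mono-≤ 1≤k (length≤sum pos)

PartsAtMost : ℕ → List Part → Set
PartsAtMost N = All (λ p → proj₁ p ≤ N)

mayPrecede⇒≥ : ∀ {p q} → MayPrecede p q → proj₁ q ≤ proj₁ p
mayPrecede⇒≥ (inj₁ q<p)       = <⇒≤ q<p
mayPrecede⇒≥ (inj₂ (q≡p , _)) = ≤-reflexive q≡p

linked⇒tail-partsAtMost : ∀ {k b y} → Linked MayPrecede ((k , b) ∷ y) → PartsAtMost k y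
linked⇒tail-partsAtMost                 [-]     = []
linked⇒tail-partsAtMost {k} {b} {q ∷ _} (r ∷ l) =
  q≤k ∷ All.map (λ p≤q → ≤-trans p≤q q≤k) (linked⇒tail-partsAtMost l)
  where
  q≤k : proj₁ q ≤ k
  q≤k = mayPrecede⇒≥ {k , b} {q} r

partsAtMost-sum : ∀ x → PartsAtMost (sum (parts x)) x
partsAtMost-sum []            = []
partsAtMost-sum ((k , b) ∷ y) =
  m≤m+n k _ ∷ All.map (λ q≤ → ≤-trans q≤ (m≤n+m _ k)) (partsAtMost-sum y)

DistinctPartsAtMost : ℕ → ℕ → List Part → Set
DistinctPartsAtMost N n x = DistinctOverpartition n x × PartsAtMost N x

prependPart : Bool → ℕ → List Part → List Part
prependPart b N y = (suc N , b) ∷ y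

module PrependPart = Enumeration [] prependPart

distinctRecurrence : PrependPart.Recurrence DistinctPartsAtMost
distinctRecurrence = record
  { base           = (([] , [] , refl) , []) , []
  ; base⁻          = base⁻
  ; weaken         = λ (x , x≤N) → x , All.map m≤n⇒m≤1+n x≤N
  ; grow⁺          = grow⁺
  ; step⁻          = step⁻
  ; grow-fresh     = λ { _ (_ , N<N ∷ _) → 1+n≰n N<N }
  ; grow-injective = λ { _ _ refl → refl , refl }
  }
  where
  base⁻ : ∀ {n x} → DistinctPartsAtMost 0 n x → n ≡ 0 × x ≡ []
  base⁻ {x = []}    (((_ , _ , sum≡n) , _) , _) = sym sum≡n , refl
  base⁻ {x = _ ∷ _} (((1≤k ∷ _ , _) , _) , k≤0 ∷ _) with ≤-trans 1≤k k≤0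
  ... | ()

  grow⁺ : ∀ {N n b y} → suc N ≤ n → DistinctPartsAtMost N (n ∸ suc N) y →
          DistinctPartsAtMost (suc N) n (prependPart b N y)
  grow⁺ {N} {n} {b} {y} N<n (((pos , linked , sum≡) , distinct) , y≤N) =
    ((s≤s z≤n ∷ pos , linked′ y≤N linked , trans (cong (suc N +_) sum≡) (m+[n∸m]≡n N<n)) ,
     Allₚ.map⁺ (All.map (λ k≤N N≡k → 1+n≰n (subst (_≤ N) (sym N≡k) k≤N)) y≤N) ∷ distinct) ,
    ≤-refl ∷ All.map m≤n⇒m≤1+n y≤N
    where
    linked′ : ∀ {y} → PartsAtMost N y → Linked MayPrecede y → Linked MayPrecede ((suc N , b) ∷ y)
    linked′ []          []   = [-]
    linked′ (k≤N ∷ _)   l    = inj₁ (s≤s k≤N) ∷ l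

  step⁻ : ∀ {N n x} → DistinctPartsAtMost (suc N) n x →
          DistinctPartsAtMost N n x ⊎ PrependPart.GrownFrom N (DistinctPartsAtMost N) n x
  step⁻ {x = []} (d , []) = inj₁ (d , [])
  step⁻ {N} {n} {(k , b) ∷ y} (d@((_ ∷ pos , linked , sum≡n) , k∉y ∷ distinct) , k≤N+1 ∷ _)
    with m≤n⇒m<n∨m≡n k≤N+1
  ... | inj₁ (s≤s k≤N) =
    inj₁ (d , k≤N ∷ All.map (λ q≤k → ≤-trans q≤k k≤N) (linked⇒tail-partsAtMost linked))
  ... | inj₂ refl      =
    inj₂ (b , y , N<n , (((pos , Linked.tail linked , sum≡) , distinct) , y≤N) , refl)
    where
    N<n : suc N ≤ n
    N<n = subst (suc N ≤_) sum≡n (m≤m+n (suc N) _)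
    sum≡ : sum (parts y) ≡ n ∸ suc N
    sum≡ = sym (trans (cong (_∸ suc N) (sym sum≡n)) (m+n∸m≡n (suc N) _))
    below : ∀ {y} → PartsAtMost (suc N) y → All (λ p → suc N ≢ proj₁ p) y → PartsAtMost N y
    below []         []         = []
    below (q≤ ∷ q≤s) (q≢ ∷ q≢s) = ≤-pred (≤∧≢⇒< q≤ (q≢ ∘ sym)) ∷ below q≤s q≢s
    y≤N : PartsAtMost N y
    y≤N = below (linked⇒tail-partsAtMost linked) (Allₚ.map⁻ k∉y)

distinct⇔partsAtMost : ∀ n x → DistinctPartsAtMost n n x ⇔ DistinctOverpartition n x
distinct⇔partsAtMost n x =
  mk⇔ proj₁ λ d@((_ , _ , sum≡n) , _) → d , subst (λ m → PartsAtMost m x) sum≡n (partsAtMost-sum x)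

inc : Part → Part
inc = map₁ suc

ones : Bool → ℕ → List Part
ones b k = (1 , b) ∷ replicate k (1 , false)

-- Adds a first column to the Ferrers diagram of y; the overline b goes to the first new 1.
addColumn : Bool → ℕ → List Part → List Part
addColumn b k y = map inc y ++ ones b k

parts-addColumn : ∀ b k y → parts (addColumn b k y) ≡ map suc (parts y) ++ replicate (suc k) 1
parts-addColumn b k y = begin
  parts (map inc y ++ ones b k)
    ≡⟨ map-++ proj₁ (map inc y) (ones b k) ⟩
  parts (map inc y) ++ parts (ones b k)
    ≡⟨ cong₂ _++_ (trans (sym (map-∘ {g = proj₁} {f = inc} y)) (map-∘ y))
                  (cong (1 ∷_) (map-replicate proj₁ k (1 , false))) ⟩
  map suc (parts y) ++ replicate (suc k) 1
    ∎

length-addColumn : ∀ b k y → length (addColumn b k y) ≡ length y + suc k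
length-addColumn b k y = begin
  length (map inc y ++ ones b k)
    ≡⟨ length-++ (map inc y) ⟩
  length (map inc y) + suc (length (replicate k (1 , false)))
    ≡⟨ cong₂ (λ l r → l + suc r) (length-map inc y) (length-replicate k) ⟩
  length y + suc k
    ∎

sum-addColumn : ∀ b k y → sum (parts (addColumn b k y)) ≡ sum (parts y) + length (addColumn b k y)
sum-addColumn b k y = begin
  sum (parts (addColumn b k y))
    ≡⟨ cong sum (parts-addColumn b k y) ⟩
  sum (map suc (parts y) ++ replicate (suc k) 1)
    ≡⟨ sum-++ (map suc (parts y)) _ ⟩
  sum (map suc (parts y)) + sum (replicate (suc k) 1)
    ≡⟨ cong₂ _+_ (sum-map-suc (parts y)) (sum-replicate-1 (suc k)) ⟩
  sum (parts y) + length (parts y) + suc k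
    ≡⟨ +-assoc (sum (parts y)) _ (suc k) ⟩
  sum (parts y) + (length (parts y) + suc k)
    ≡⟨ cong (λ l → sum (parts y) + (l + suc k)) (length-map proj₁ y) ⟩
  sum (parts y) + (length y + suc k)
    ≡⟨ cong (sum (parts y) +_) (length-addColumn b k y) ⟨
  sum (parts y) + length (addColumn b k y)
    ∎

mayPrecede-inc⁺ : ∀ p q → MayPrecede p q → MayPrecede (inc p) (inc q)
mayPrecede-inc⁺ _ _ (inj₁ q<p)        = inj₁ (s≤s q<p)
mayPrecede-inc⁺ _ _ (inj₂ (q≡p , c≡)) = inj₂ (cong suc q≡p , c≡)

mayPrecede-inc⁻ : ∀ p q → MayPrecede (inc p) (inc q) → MayPrecede p q
mayPrecede-inc⁻ _ _ (inj₁ q<p)        = inj₁ (≤-pred q<p)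
mayPrecede-inc⁻ _ _ (inj₂ (q≡p , c≡)) = inj₂ (suc-injective q≡p , c≡)

linked-ones : ∀ b k → Linked MayPrecede (ones b k)
linked-ones b zero    = [-]
linked-ones b (suc k) = inj₂ (refl , refl) ∷ linked-ones false k

linked-addColumn⁺ : ∀ b k {y} → Positive y → Linked MayPrecede y →
                    Linked MayPrecede (addColumn b k y)
linked-addColumn⁺ b k              []         []      = linked-ones b k
linked-addColumn⁺ b k              (1≤k ∷ []) [-]     = inj₁ (s≤s 1≤k) ∷ linked-ones b k
linked-addColumn⁺ b k {p ∷ q ∷ _} (_ ∷ pos)  (r ∷ l) =
  mayPrecede-inc⁺ p q r ∷ linked-addColumn⁺ b k pos l

linked-addColumn⁻ : ∀ {y v} → Linked MayPrecede (map inc y ++ v) → Linked MayPrecede y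
linked-addColumn⁻ {[]}        _       = []
linked-addColumn⁻ {_ ∷ []}    _       = [-]
linked-addColumn⁻ {p ∷ q ∷ _} (r ∷ l) = mayPrecede-inc⁻ p q r ∷ linked-addColumn⁻ l

isOverpartition-addColumn⁺ : ∀ b k {m y} → IsOverpartition m y →
                             IsOverpartition (m + length (addColumn b k y)) (addColumn b k y)
isOverpartition-addColumn⁺ b k {y = y} (pos , linked , sum≡m) =
  Allₚ.++⁺ (Allₚ.map⁺ (All.map (λ _ → s≤s z≤n) pos)) (s≤s z≤n ∷ Allₚ.replicate⁺ k (s≤s z≤n)) ,
  linked-addColumn⁺ b k pos linked ,
  trans (sum-addColumn b k y) (cong (_+ _) sum≡m)

isOverpartition-addColumn⁻ : ∀ b k {n y} → Positive y → IsOverpartition n (addColumn b k y) →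
                             IsOverpartition (n ∸ length (addColumn b k y)) y
isOverpartition-addColumn⁻ b k {n} {y} pos (_ , linked , sum≡n) =
  pos , linked-addColumn⁻ linked ,
  sym (trans (cong (_∸ L) (trans (sym sum≡n) (sum-addColumn b k y))) (m+n∸n≡m (sum (parts y)) L))
  where L = length (addColumn b k y)

gapFree-addColumn⁺ : ∀ b k {y} → GapFree y → GapFree (addColumn b k y)
gapFree-addColumn⁺ b k {y} gapFree =
  noGaps⇒gapFree (subst NoGaps (sym (parts-addColumn b k y)) (noGaps-column⁺ k (gapFree⇒noGaps gapFree)))

gapFree-addColumn⁻ : ∀ b k {y} → GapFree (addColumn b k y) → GapFree y
gapFree-addColumn⁻ b k {y} gapFree =
  noGaps⇒gapFree (noGaps-column⁻ k (subst NoGaps (parts-addColumn b k y) (gapFree⇒noGaps gapFree)))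

linked-one⇒ones : ∀ {b r} → Linked MayPrecede ((1 , b) ∷ r) → Positive r →
                  r ≡ replicate (length r) (1 , false)
linked-one⇒ones {r = []}    _                         _             = refl
linked-one⇒ones {r = _ ∷ _} (inj₁ (s≤s ()) ∷ _)       (s≤s z≤n ∷ _)
linked-one⇒ones {r = _ ∷ _} (inj₂ (refl , refl) ∷ l) (_ ∷ pos)     =
  cong ((1 , false) ∷_) (linked-one⇒ones l pos)

peelColumn : ∀ {x} → Positive x → Linked MayPrecede x → 1 ∈ parts x →
             Σ (List Part) λ y → Σ Bool λ b → Σ ℕ λ k → Positive y × x ≡ addColumn b k y
peelColumn {(suc zero , b) ∷ r}    (_ ∷ pos) linked _ =
  [] , b , length r , [] , cong ((1 , b) ∷_) (linked-one⇒ones linked pos)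
peelColumn {(suc (suc m) , c) ∷ r} (_ ∷ pos) linked (there 1∈r)
  with peelColumn pos (Linked.tail linked) 1∈r
... | y , b , k , pos-y , r≡ =
  (suc m , c) ∷ y , b , k , s≤s z≤n ∷ pos-y , cong ((suc (suc m) , c) ∷_) r≡

addColumn-injective : ∀ {b b′ k k′ y y′} → Positive y → Positive y′ →
                      addColumn b k y ≡ addColumn b′ k′ y′ → b ≡ b′ × y ≡ y′
addColumn-injective {y = []} {[]} _ _ eq = cong proj₂ (∷-injectiveˡ eq) , refl
addColumn-injective {y = []} {_ ∷ _} _ (s≤s z≤n ∷ _) eq with ∷-injectiveˡ eq
... | ()
addColumn-injective {y = _ ∷ _} {[]} (s≤s z≤n ∷ _) _ eq with ∷-injectiveˡ eq
... | ()
addColumn-injective {y = (k , c) ∷ y} {(k′ , c′) ∷ y′} (_ ∷ pos) (_ ∷ pos′) eq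
  with ∷-injectiveˡ eq | addColumn-injective pos pos′ (∷-injectiveʳ eq)
... | refl | b≡b′ , y≡y′ = b≡b′ , cong ((k , c) ∷_) y≡y′

growColumn : Bool → ℕ → List Part → List Part
growColumn b N y = addColumn b (N ∸ length y) y

length-growColumn : ∀ b {N} y → length y ≤ N → length (growColumn b N y) ≡ suc N
length-growColumn b {N} y len≤N =
  trans (length-addColumn b (N ∸ length y) y) (trans (+-suc (length y) _) (cong suc (m+[n∸m]≡n len≤N)))

addColumn≡growColumn : ∀ b k {N} y → length (addColumn b k y) ≡ suc N →
                       length y ≤ N × addColumn b k y ≡ growColumn b N y
addColumn≡growColumn b k {N} y len≡ =
  subst (length y ≤_) L+k≡N (m≤m+n (length y) k) ,
  cong (λ k′ → addColumn b k′ y) (trans (sym (m+n∸m≡n (length y) k)) (cong (_∸ length y) L+k≡N))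
  where
  L+k≡N : length y + k ≡ N
  L+k≡N = suc-injective (trans (sym (+-suc (length y) k)) (trans (sym (length-addColumn b k y)) len≡))

GapFreeLengthAtMost : ℕ → ℕ → List Part → Set
GapFreeLengthAtMost N n x = GapFreeOverpartition n x × length x ≤ N

module GrowColumn = Enumeration [] growColumn

1∈parts : ∀ {N n x} → GapFreeOverpartition n x → length x ≡ suc N → 1 ∈ parts x
1∈parts {x = x@(_ ∷ _)} ((1≤p ∷ _ , _) , gapFree) _ =
  noGaps⇒1∈ (gapFree⇒noGaps {x} gapFree) 1≤p (here refl)

gapFree-peelColumn : ∀ {N n x} → GapFreeOverpartition n x → length x ≡ suc N →
                     GrowColumn.GrownFrom N (GapFreeLengthAtMost N) n x
gapFree-peelColumn {N} {n} (ovp@(pos , linked , sum≡n) , gapFree) len≡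
  with peelColumn pos linked (1∈parts (ovp , gapFree) len≡)
... | y , b , k , pos-y , refl with addColumn≡growColumn b k y len≡
... | len-y≤N , x≡ = b , y , N<n , ((ovp-y , gapFree-addColumn⁻ b k gapFree) , len-y≤N) , x≡
  where
  N<n : suc N ≤ n
  N<n = subst₂ _≤_ len≡ sum≡n (length≤sum pos)
  ovp-y : IsOverpartition (n ∸ suc N) y
  ovp-y = subst (λ L → IsOverpartition (n ∸ L) y) len≡ (isOverpartition-addColumn⁻ b k pos-y ovp)

gapFreeRecurrence : GrowColumn.Recurrence GapFreeLengthAtMost
gapFreeRecurrence = record
  { base           = (([] , [] , refl) , λ _ _ ()) , z≤n
  ; base⁻          = base⁻
  ; weaken         = λ (x , len≤N) → x , m≤n⇒m≤1+n len≤N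
  ; grow⁺          = grow⁺
  ; step⁻          = step⁻
  ; grow-fresh     = grow-fresh
  ; grow-injective = λ { (((pos , _) , _) , _) (((pos′ , _) , _) , _) → addColumn-injective pos pos′ }
  }
  where
  base⁻ : ∀ {n x} → GapFreeLengthAtMost 0 n x → n ≡ 0 × x ≡ []
  base⁻ {x = []} (((_ , _ , sum≡n) , _) , _) = sym sum≡n , refl

  grow⁺ : ∀ {N n b y} → suc N ≤ n → GapFreeLengthAtMost N (n ∸ suc N) y →
          GapFreeLengthAtMost (suc N) n (growColumn b N y)
  grow⁺ {N} {n} {b} {y} N<n ((ovp , gapFree) , len≤N) =
    (subst (λ m → IsOverpartition m x) n≡ (isOverpartition-addColumn⁺ b _ ovp) ,
     gapFree-addColumn⁺ b _ gapFree) ,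
    ≤-reflexive (length-growColumn b y len≤N)
    where
    x = growColumn b N y
    n≡ : n ∸ suc N + length x ≡ n
    n≡ = trans (cong (n ∸ suc N +_) (length-growColumn b y len≤N)) (m∸n+n≡m N<n)

  grow-fresh : ∀ {N m n b y} → GapFreeLengthAtMost N m y → ¬ GapFreeLengthAtMost N n (growColumn b N y)
  grow-fresh {N} {b = b} {y} (_ , len≤N) (_ , len′≤N) =
    1+n≰n (subst (_≤ N) (length-growColumn b y len≤N) len′≤N)

  step⁻ : ∀ {N n x} → GapFreeLengthAtMost (suc N) n x →
          GapFreeLengthAtMost N n x ⊎ GrowColumn.GrownFrom N (GapFreeLengthAtMost N) n x
  step⁻ (gapFreeOvp , len≤N+1) with m≤n⇒m<n∨m≡n len≤N+1
  ... | inj₁ (s≤s len≤N) = inj₁ (gapFreeOvp , len≤N)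
  ... | inj₂ len≡        = inj₂ (gapFree-peelColumn gapFreeOvp len≡)

gapFree⇔lengthAtMost : ∀ n x → GapFreeLengthAtMost n n x ⇔ GapFreeOverpartition n x
gapFree⇔lengthAtMost n x =
  mk⇔ proj₁ λ g@((pos , _ , sum≡n) , _) → g , subst (length x ≤_) sum≡n (length≤sum pos)

corollary3p3 : (n : ℕ) →
    HasCount (GapFreeOverpartition n) (coeffMinus2q n)
      × HasCount (DistinctOverpartition n) (coeffMinus2q n)
corollary3p3 n =
  HasCount-resp-⇔ (gapFree⇔lengthAtMost n) (GrowColumn.hasCount gapFreeRecurrence n n) ,
  HasCount-resp-⇔ (distinct⇔partsAtMost n) (PrependPart.hasCount distinctRecurrence n n)
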